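{- Let $G=(V,E)$ be a $P(2,1)$-graph. Then there is a unique over-critical set $X\subseteq V$ of minimum cardinality, and the induced subgraph $G[X]$ is a $(2,2)$-circuit.
   Context: Graphs are finite multigraphs, loops allowed. A graph is $(k,\ell)$-sparse if every subgraph $(V',E')$ with at least one edge has $|E'|\le k|V'|-\ell$, and $(k,\ell)$-tight if also $|E|=k|V|-\ell$. A $P(2,1)$-graph is a $(2,1)$-tight graph $G$ such that $G-e$ is $(2,2)$-tight for some edge $e$. A $(2,2)$-circuit is a graph $H$ with $|E(H)|=2|V(H)|-1$ such that $H-e$ is $(2,2)$-tight for every edge $e$. For $X\subseteq V$, $G[X]$ is the induced subgraph and $i(X)$ its number of edges; $X$ is over-critical if $i(X)=2|X|-1$. -}

module Defs where

open import Data.Nat using (ℕ; _+_; _*_; _≤_)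
open import Data.Bool using (_∧_)
open import Data.Fin using (Fin)
open import Data.Fin.Subset using (Subset; ⊤; _∈_; _⊆_; _-_; ∣_∣)
open import Data.Product using (_×_; Σ; ∃; _,_; proj₁; proj₂)
open import Data.Vec using (lookup; tabulate)
open import Relation.Binary.PropositionalEquality using (_≡_)

-- A finite multigraph (loops and parallel edges allowed):
-- vertices Fin n, edges Fin m, each edge has a pair of endpoints.
record Graph : Set where
  field
    n    : ℕ
    m    : ℕ
    ends : Fin m → Fin n × Fin n

open Graph public

-- A graph H living inside G, given by a vertex set and an edge set of G.
-- (All the notions below are isomorphism-invariant, so we work with
--  subgraphs of a fixed ambient graph G instead of re-indexing.)
record Sub (G : Graph) : Set where
  constructor ⟨_,_⟩
  field
    verts : Subset (n G)
    edges : Subset (m G)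

open Sub public

IsSubgraphOf : {G : Graph} → Sub G → Sub G → Set
IsSubgraphOf {G} H' H =
  (verts H' ⊆ verts H) × (edges H' ⊆ edges H) ×
  (∀ e → e ∈ edges H' → (proj₁ (ends G e) ∈ verts H') × (proj₂ (ends G e) ∈ verts H'))

-- (k,ℓ)-sparse: every subgraph (V',E') with at least one edge has
-- |E'| ≤ k|V'| - ℓ  (stated over ℕ as |E'| + ℓ ≤ k|V'|).
Sparse : ℕ → ℕ → {G : Graph} → Sub G → Set
Sparse k ℓ H = ∀ H' → IsSubgraphOf H' H → 1 ≤ ∣ edges H' ∣ →
  ∣ edges H' ∣ + ℓ ≤ k * ∣ verts H' ∣

Tight : ℕ → ℕ → {G : Graph} → Sub G → Set
Tight k ℓ H = Sparse k ℓ H × (∣ edges H ∣ + ℓ ≡ k * ∣ verts H ∣)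

whole : (G : Graph) → Sub G
whole G = ⟨ ⊤ , ⊤ ⟩

deleteEdge : {G : Graph} → Sub G → Fin (m G) → Sub G
deleteEdge H e = ⟨ verts H , edges H - e ⟩

IsP21 : Graph → Set
IsP21 G = Tight 2 1 (whole G) × ∃ λ e → Tight 2 2 (deleteEdge (whole G) e)

IsCircuit22 : {G : Graph} → Sub G → Set
IsCircuit22 H = (∣ edges H ∣ + 1 ≡ 2 * ∣ verts H ∣) ×
  (∀ e → e ∈ edges H → Tight 2 2 (deleteEdge H e))

induced : (G : Graph) → Subset (n G) → Sub G
induced G X = ⟨ X , tabulate (λ e → lookup X (proj₁ (ends G e)) ∧ lookup X (proj₂ (ends G e))) ⟩

i : (G : Graph) → Subset (n G) → ℕ
i G X = ∣ edges (induced G X) ∣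

OverCritical : (G : Graph) → Subset (n G) → Set
OverCritical G X = i G X + 1 ≡ 2 * ∣ X ∣

module Submission where

-- Call X ⊆ V k,ℓ-critical if i(X) + ℓ = k|X|.  Since i is
-- supermodular (i(X) + i(Y) ≤ i(X∩Y) + i(X∪Y)) and |·| is modular, in a
-- (k,ℓ)-sparse graph two critical sets whose intersection spans an edge
-- have a critical intersection.  In a P(2,1)-graph G with G - e₀ (2,2)-tight,
-- every over-critical (= 2,1-critical) set spans an edge (parity) and in
-- fact spans e₀ (otherwise G[X] would violate (2,2)-sparsity of G - e₀), so
-- the over-critical sets, which include V itself, are closed under ∩.  The
-- intersection of all of them is therefore the LEAST over-critical set X₀;
-- leastness gives minimum cardinality and uniqueness at once.  Finally a
-- least critical set X of a (k,ℓ)-sparse graph makes G[X] - f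
-- (k,ℓ+1)-tight for each edge f of G[X]: a subgraph attaining the (k,ℓ)
-- bound would have a critical vertex set, hence equal to X, yet lack f.

open import Defs
open import Data.Nat using (ℕ; zero; suc; _≤_; _<_; _+_; _*_; s≤s; z≤n)
open import Data.Nat.Properties
open import Algebra.Properties.CommutativeSemigroup +-commutativeSemigroup
  using (interchange)
open import Data.Bool using (true; _∧_)
open import Data.Bool.Properties using (∧-conicalˡ; ∧-conicalʳ)
open import Data.Fin using (Fin)
open import Data.Fin.Subset
  using (Subset; ∣_∣; _∩_; _∪_; _⊆_; _∈_; _-_; ⊤; ⋂; inside; outside)
open import Data.Fin.Subset.Properties
open import Data.Vec using ([]; _∷_; here; there; lookup)
open import Data.Vec.Properties using ([]=⇒lookup; lookup⇒[]=; lookup∘tabulate)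
open import Data.List using (List; map; _++_; filter)
  renaming ([] to []ₗ; _∷_ to _∷ₗ_)
open import Data.List.Membership.Propositional using () renaming (_∈_ to _∈ₗ_)
open import Data.List.Membership.Propositional.Properties
  using (∈-map⁺; ∈-++⁺ˡ; ∈-++⁺ʳ; ∈-filter⁺)
open import Data.List.Relation.Unary.All using (All) renaming ([] to []ᵃ; _∷_ to _∷ᵃ_)
open import Data.List.Relation.Unary.All.Properties using (all-filter)
open import Data.List.Relation.Unary.Any using () renaming (here to hereₗ; there to thereₗ)
open import Data.Product using (_×_; ∃; _,_; proj₁; proj₂)
open import Data.Sum using (inj₁; inj₂)
open import Relation.Nullary using (yes; no; contradiction)
open import Relation.Unary using (Decidable)
open import Relation.Binary.PropositionalEquality

∣p∩q∣+∣p∪q∣≡∣p∣+∣q∣ : ∀ {k} (p q : Subset k) → ∣ p ∩ q ∣ + ∣ p ∪ q ∣ ≡ ∣ p ∣ + ∣ q ∣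
∣p∩q∣+∣p∪q∣≡∣p∣+∣q∣ [] [] = refl
∣p∩q∣+∣p∪q∣≡∣p∣+∣q∣ (inside ∷ p) (inside ∷ q) =
  cong suc (trans (+-suc _ _) (trans (cong suc (∣p∩q∣+∣p∪q∣≡∣p∣+∣q∣ p q)) (sym (+-suc _ _))))
∣p∩q∣+∣p∪q∣≡∣p∣+∣q∣ (inside ∷ p) (outside ∷ q) =
  trans (+-suc _ _) (cong suc (∣p∩q∣+∣p∪q∣≡∣p∣+∣q∣ p q))
∣p∩q∣+∣p∪q∣≡∣p∣+∣q∣ (outside ∷ p) (inside ∷ q) =
  trans (+-suc _ _) (trans (cong suc (∣p∩q∣+∣p∪q∣≡∣p∣+∣q∣ p q)) (sym (+-suc _ _)))
∣p∩q∣+∣p∪q∣≡∣p∣+∣q∣ (outside ∷ p) (outside ∷ q) = ∣p∩q∣+∣p∪q∣≡∣p∣+∣q∣ p q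

∣p-x∣+1≡∣p∣ : ∀ {k} (p : Subset k) x → x ∈ p → ∣ p - x ∣ + 1 ≡ ∣ p ∣
∣p-x∣+1≡∣p∣ (inside ∷ p) Fin.zero here = trans (+-comm _ 1) (cong (λ q → suc ∣ q ∣) (p─⊥≡p p))
∣p-x∣+1≡∣p∣ (inside ∷ p) (Fin.suc x) (there x∈p) = cong suc (∣p-x∣+1≡∣p∣ p x x∈p)
∣p-x∣+1≡∣p∣ (outside ∷ p) (Fin.suc x) (there x∈p) = ∣p-x∣+1≡∣p∣ p x x∈p

x∈p⇒1≤∣p∣ : ∀ {k} {p : Subset k} {x} → x ∈ p → 1 ≤ ∣ p ∣
x∈p⇒1≤∣p∣ x∈p = ≤-trans (s≤s z≤n) (x∈p⇒∣p-x∣<∣p∣ x∈p)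

⊆∧∣≤∣⇒≡ : ∀ {k} {p q : Subset k} → p ⊆ q → ∣ q ∣ ≤ ∣ p ∣ → q ≡ p
⊆∧∣≤∣⇒≡ {p = p} {q} p⊆q ∣q∣≤∣p∣ = ⊆-antisym q⊆p p⊆q
  where
  q⊆p : q ⊆ p
  q⊆p {x} x∈q with x ∈? p
  ... | yes x∈p = x∈p
  ... | no x∉p = contradiction (p⊂q⇒∣p∣<∣q∣ (p⊆q , x , x∈q , x∉p)) (≤⇒≯ ∣q∣≤∣p∣)

subsets : ∀ k → List (Subset k)
subsets zero = [] ∷ₗ []ₗ
subsets (suc k) = map (inside ∷_) (subsets k) ++ map (outside ∷_) (subsets k)

∈-subsets : ∀ {k} (p : Subset k) → p ∈ₗ subsets k
∈-subsets [] = hereₗ refl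
∈-subsets {suc k} (inside ∷ p) = ∈-++⁺ˡ (∈-map⁺ (inside ∷_) (∈-subsets p))
∈-subsets {suc k} (outside ∷ p) =
  ∈-++⁺ʳ (map (inside ∷_) (subsets k)) (∈-map⁺ (outside ∷_) (∈-subsets p))

module LeastMember {k : ℕ} {P : Subset k → Set} (P? : Decidable P)
                   (P-⊤ : P ⊤) (P-∩ : ∀ {X Y} → P X → P Y → P (X ∩ Y)) where

  ⋂-closed : ∀ {Xs} → All P Xs → P (⋂ Xs)
  ⋂-closed []ᵃ = P-⊤
  ⋂-closed (PX ∷ᵃ PXs) = P-∩ PX (⋂-closed PXs)

  ⋂-⊆ : ∀ {X : Subset k} {Xs} → X ∈ₗ Xs → ⋂ Xs ⊆ X
  ⋂-⊆ {Xs = X ∷ₗ Xs} (hereₗ refl) = p∩q⊆p X (⋂ Xs)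
  ⋂-⊆ {Xs = Z ∷ₗ Xs} (thereₗ X∈Xs) = ⊆-trans (p∩q⊆q Z (⋂ Xs)) (⋂-⊆ X∈Xs)

  least : Subset k
  least = ⋂ (filter P? (subsets k))

  least-∈ : P least
  least-∈ = ⋂-closed (all-filter P? (subsets k))

  least-⊆ : ∀ {Y} → P Y → least ⊆ Y
  least-⊆ {Y} PY = ⋂-⊆ (∈-filter⁺ P? (∈-subsets Y) PY)

module Induced (G : Graph) where

  E : Subset (n G) → Subset (m G)
  E X = edges (induced G X)

  tail head : Fin (m G) → Fin (n G)
  tail e = proj₁ (ends G e)
  head e = proj₂ (ends G e)

  E-lookup : ∀ X e → lookup (E X) e ≡ lookup X (tail e) ∧ lookup X (head e)
  E-lookup X = lookup∘tabulate (λ e → lookup X (tail e) ∧ lookup X (head e))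

  ∈E⁻ : ∀ X {e} → e ∈ E X → tail e ∈ X × head e ∈ X
  ∈E⁻ X {e} e∈ = lookup⇒[]= _ X (∧-conicalˡ _ _ ends-in) , lookup⇒[]= _ X (∧-conicalʳ _ _ ends-in)
    where
    ends-in : lookup X (tail e) ∧ lookup X (head e) ≡ true
    ends-in = trans (sym (E-lookup X e)) ([]=⇒lookup e∈)

  ∈E⁺ : ∀ X {e} → tail e ∈ X → head e ∈ X → e ∈ E X
  ∈E⁺ X {e} t h = lookup⇒[]= e (E X) (begin
    lookup (E X) e                         ≡⟨ E-lookup X e ⟩
    lookup X (tail e) ∧ lookup X (head e)  ≡⟨ cong₂ _∧_ ([]=⇒lookup t) ([]=⇒lookup h) ⟩
    true                                   ∎)
    where open ≡-Reasoning

  E-mono : ∀ {X Y} → X ⊆ Y → E X ⊆ E Y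
  E-mono {X} {Y} X⊆Y e∈ = ∈E⁺ Y (X⊆Y (proj₁ (∈E⁻ X e∈))) (X⊆Y (proj₂ (∈E⁻ X e∈)))

  edges⊆E-verts : ∀ {H' H : Sub G} → IsSubgraphOf H' H → edges H' ⊆ E (verts H')
  edges⊆E-verts {H'} (_ , _ , ends∈) e∈ = ∈E⁺ (verts H') (proj₁ (ends∈ _ e∈)) (proj₂ (ends∈ _ e∈))

  induced-⊑ : ∀ {X} (H : Sub G) → X ⊆ verts H → E X ⊆ edges H → IsSubgraphOf (induced G X) H
  induced-⊑ {X} H X⊆ E⊆ = X⊆ , E⊆ , λ e e∈ → ∈E⁻ X e∈

  E-∩ : ∀ X Y → E X ∩ E Y ⊆ E (X ∩ Y)
  E-∩ X Y e∈ with x∈p∩q⁻ (E X) (E Y) e∈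
  ... | e∈X , e∈Y = ∈E⁺ (X ∩ Y) (x∈p∩q⁺ (proj₁ (∈E⁻ X e∈X) , proj₁ (∈E⁻ Y e∈Y)))
                                (x∈p∩q⁺ (proj₂ (∈E⁻ X e∈X) , proj₂ (∈E⁻ Y e∈Y)))

  E-∪ : ∀ X Y → E X ∪ E Y ⊆ E (X ∪ Y)
  E-∪ X Y e∈ with x∈p∪q⁻ (E X) (E Y) e∈
  ... | inj₁ e∈X = E-mono (p⊆p∪q {p = X} Y) e∈X
  ... | inj₂ e∈Y = E-mono (q⊆p∪q X Y) e∈Y

  i-supermodular : ∀ X Y → i G X + i G Y ≤ i G (X ∩ Y) + i G (X ∪ Y)
  i-supermodular X Y = begin
    ∣ E X ∣ + ∣ E Y ∣               ≡⟨ sym (∣p∩q∣+∣p∪q∣≡∣p∣+∣q∣ (E X) (E Y)) ⟩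
    ∣ E X ∩ E Y ∣ + ∣ E X ∪ E Y ∣   ≤⟨ +-mono-≤ (p⊆q⇒∣p∣≤∣q∣ (E-∩ X Y)) (p⊆q⇒∣p∣≤∣q∣ (E-∪ X Y)) ⟩
    ∣ E (X ∩ Y) ∣ + ∣ E (X ∪ Y) ∣   ∎
    where open ≤-Reasoning

  E-⊤ : E ⊤ ≡ ⊤
  E-⊤ = ⊆-antisym ⊆⊤ (λ _ → ∈E⁺ ⊤ ∈⊤ ∈⊤)

Critical : ℕ → ℕ → (G : Graph) → Subset (n G) → Set
Critical k ℓ G X = i G X + ℓ ≡ k * ∣ X ∣

squeeze : ∀ {u U v V} → u ≤ U → v ≤ V → U + V ≤ u + v → U ≡ u
squeeze {u} {U} {v} {V} u≤U v≤V U+V≤u+v =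
  ≤-antisym (+-cancelʳ-≤ V U u (≤-trans U+V≤u+v (+-monoʳ-≤ u v≤V))) u≤U

module SparseGraph (G : Graph) {k ℓ : ℕ} where
  open Induced G

  i-bound : Sparse k ℓ (whole G) → ∀ X → 1 ≤ i G X → i G X + ℓ ≤ k * ∣ X ∣
  i-bound sparse X = sparse (induced G X) (induced-⊑ (whole G) (λ _ → ∈⊤) (λ _ → ∈⊤))

  critical-∩ : Sparse k ℓ (whole G) → ∀ {X Y} → Critical k ℓ G X → Critical k ℓ G Y →
               1 ≤ i G (X ∩ Y) → Critical k ℓ G (X ∩ Y)
  critical-∩ sparse {X} {Y} crX crY 1≤i∩ =
    sym (squeeze (i-bound sparse (X ∩ Y) 1≤i∩) (i-bound sparse (X ∪ Y) 1≤i∪) counts)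
    where
    1≤i∪ : 1 ≤ i G (X ∪ Y)
    1≤i∪ = ≤-trans 1≤i∩ (p⊆q⇒∣p∣≤∣q∣ (E-mono (⊆-trans (p∩q⊆p X Y) (p⊆p∪q {p = X} Y))))
    counts : k * ∣ X ∩ Y ∣ + k * ∣ X ∪ Y ∣ ≤ (i G (X ∩ Y) + ℓ) + (i G (X ∪ Y) + ℓ)
    counts = begin
      k * ∣ X ∩ Y ∣ + k * ∣ X ∪ Y ∣       ≡⟨ sym (*-distribˡ-+ k ∣ X ∩ Y ∣ ∣ X ∪ Y ∣) ⟩
      k * (∣ X ∩ Y ∣ + ∣ X ∪ Y ∣)         ≡⟨ cong (k *_) (∣p∩q∣+∣p∪q∣≡∣p∣+∣q∣ X Y) ⟩
      k * (∣ X ∣ + ∣ Y ∣)                 ≡⟨ *-distribˡ-+ k ∣ X ∣ ∣ Y ∣ ⟩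
      k * ∣ X ∣ + k * ∣ Y ∣               ≡⟨ cong₂ _+_ (sym crX) (sym crY) ⟩
      (i G X + ℓ) + (i G Y + ℓ)           ≡⟨ interchange (i G X) ℓ (i G Y) ℓ ⟩
      (i G X + i G Y) + (ℓ + ℓ)           ≤⟨ +-monoˡ-≤ (ℓ + ℓ) (i-supermodular X Y) ⟩
      (i G (X ∩ Y) + i G (X ∪ Y)) + (ℓ + ℓ) ≡⟨ interchange (i G (X ∩ Y)) (i G (X ∪ Y)) ℓ ℓ ⟩
      (i G (X ∩ Y) + ℓ) + (i G (X ∪ Y) + ℓ) ∎
      where open ≤-Reasoning

  critical-spans : ∀ {e} → Sparse k (suc ℓ) (deleteEdge (whole G) e) →
                   ∀ {X} → Critical k ℓ G X → 1 ≤ i G X → e ∈ E X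
  critical-spans {e} sparse {X} crX 1≤iX with e ∈? E X
  ... | yes e∈ = e∈
  ... | no e∉ = contradiction (sparse (induced G X) avoids-e 1≤iX) (<⇒≱ too-dense)
    where
    avoids-e : IsSubgraphOf (induced G X) (deleteEdge (whole G) e)
    avoids-e = induced-⊑ (deleteEdge (whole G) e) (λ _ → ∈⊤)
                 (λ {f} f∈ → x∈p∧x≢y⇒x∈p-y ∈⊤ (λ f≡e → e∉ (subst (_∈ E X) f≡e f∈)))
    too-dense : k * ∣ X ∣ < i G X + suc ℓ
    too-dense = subst (_< i G X + suc ℓ) crX (≤-reflexive (sym (+-suc (i G X) ℓ)))

  least-critical-tight : Sparse k ℓ (whole G) → ∀ {X} → Critical k ℓ G X →
    (∀ Y → Critical k ℓ G Y → X ⊆ Y) →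
    ∀ f → f ∈ E X → Tight k (suc ℓ) (deleteEdge (induced G X) f)
  least-critical-tight sparse {X} crX least f f∈ = sparse' , count
    where
    count : ∣ E X - f ∣ + suc ℓ ≡ k * ∣ X ∣
    count = begin
      ∣ E X - f ∣ + suc ℓ     ≡⟨ +-suc ∣ E X - f ∣ ℓ ⟩
      suc (∣ E X - f ∣ + ℓ)   ≡⟨ cong (_+ ℓ) (trans (+-comm 1 _) (∣p-x∣+1≡∣p∣ (E X) f f∈)) ⟩
      i G X + ℓ               ≡⟨ crX ⟩
      k * ∣ X ∣               ∎
      where open ≡-Reasoning
    -- A subgraph H' of G[X] - f meets the (k,ℓ) bound of G; it cannot attain it.
    sparse' : Sparse k (suc ℓ) (deleteEdge (induced G X) f)
    sparse' H' (W⊆X , E'⊆ , ends∈) 1≤E'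
      with m≤n⇒m<n∨m≡n (sparse H' ((λ _ → ∈⊤) , (λ _ → ∈⊤) , ends∈) 1≤E')
    ... | inj₁ below = subst (_≤ k * ∣ verts H' ∣) (sym (+-suc _ ℓ)) below
    ... | inj₂ attains = contradiction lacks-f (<⇒≱ too-many)
      where
      W : Subset (n G)
      W = verts H'
      E' : Subset (m G)
      E' = edges H'
      E'≤iW : ∣ E' ∣ ≤ i G W
      E'≤iW = p⊆q⇒∣p∣≤∣q∣ (edges⊆E-verts (W⊆X , E'⊆ , ends∈))
      -- attaining the bound makes V(H') critical, hence equal to X
      crW : Critical k ℓ G W
      crW = ≤-antisym (i-bound sparse W (≤-trans 1≤E' E'≤iW))
                      (subst (_≤ i G W + ℓ) attains (+-monoˡ-≤ ℓ E'≤iW))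
      W≡X : W ≡ X
      W≡X = ⊆-antisym W⊆X (least W crW)
      iX≡ : i G X ≡ ∣ E' ∣
      iX≡ = subst (λ Z → i G Z ≡ ∣ E' ∣) W≡X (+-cancelʳ-≡ ℓ (i G W) ∣ E' ∣ (trans crW (sym attains)))
      -- H' misses f, yet has as many edges as G[X]
      lacks-f : ∣ E' ∣ ≤ ∣ E X - f ∣
      lacks-f = p⊆q⇒∣p∣≤∣q∣ E'⊆
      too-many : ∣ E X - f ∣ < ∣ E' ∣
      too-many = ≤-reflexive (trans (+-comm 1 _) (trans (∣p-x∣+1≡∣p∣ (E X) f f∈) iX≡))

-- Over-critical sets span an edge: i(X) + 1 = 2|X| forces i(X) to be odd.
odd⇒1≤ : ∀ u w → u + 1 ≡ 2 * w → 1 ≤ u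
odd⇒1≤ (suc u) w _ = s≤s z≤n
odd⇒1≤ zero zero ()
odd⇒1≤ zero (suc w) 1≡2+2w with trans 1≡2+2w (*-suc 2 w)
... | ()

module P21 (G : Graph) (P : IsP21 G) where
  open Induced G
  open SparseGraph G {2} {1}

  sparse-G : Sparse 2 1 (whole G)
  sparse-G = proj₁ (proj₁ P)

  e₀ : Fin (m G)
  e₀ = proj₁ (proj₂ P)

  sparse-G-e₀ : Sparse 2 2 (deleteEdge (whole G) e₀)
  sparse-G-e₀ = proj₁ (proj₂ (proj₂ P))

  e₀-spanned : ∀ {X} → OverCritical G X → e₀ ∈ E X
  e₀-spanned {X} oc = critical-spans sparse-G-e₀ {X} oc (odd⇒1≤ (i G X) ∣ X ∣ oc)

  overCritical-∩ : ∀ {X Y} → OverCritical G X → OverCritical G Y → OverCritical G (X ∩ Y)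
  overCritical-∩ {X} {Y} ocX ocY = critical-∩ sparse-G {X} {Y} ocX ocY
    (x∈p⇒1≤∣p∣ (E-∩ X Y (x∈p∩q⁺ (e₀-spanned {X} ocX , e₀-spanned {Y} ocY))))

  overCritical-⊤ : OverCritical G ⊤
  overCritical-⊤ = subst (λ F → ∣ F ∣ + 1 ≡ 2 * ∣ ⊤ {n G} ∣) (sym E-⊤) (proj₂ (proj₁ P))

  open LeastMember {P = OverCritical G} (λ X → i G X + 1 ≟ 2 * ∣ X ∣)
                   overCritical-⊤ (λ {X} {Y} → overCritical-∩ {X} {Y})
    using () renaming (least to X₀; least-∈ to X₀-overCritical; least-⊆ to X₀-⊆) public

lemma5p1 : (G : Graph) → IsP21 G →
    ∃ λ (X : Subset (n G)) →
      OverCritical G X ×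
      (∀ Y → OverCritical G Y → ∣ X ∣ ≤ ∣ Y ∣) ×
      (∀ Y → OverCritical G Y → ∣ Y ∣ ≡ ∣ X ∣ → Y ≡ X) ×
      IsCircuit22 (induced G X)
lemma5p1 G P =
  X₀ , X₀-overCritical ,
  (λ Y ocY → p⊆q⇒∣p∣≤∣q∣ (X₀-⊆ {Y} ocY)) ,
  (λ Y ocY ∣Y∣≡∣X₀∣ → ⊆∧∣≤∣⇒≡ (X₀-⊆ {Y} ocY) (≤-reflexive ∣Y∣≡∣X₀∣)) ,
  X₀-overCritical ,
  least-critical-tight sparse-G X₀-overCritical (λ Y → X₀-⊆ {Y})
  where
  open P21 G P
  open SparseGraph G {2} {1}
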